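{- Let $D_G$ and $D_H$ be graphs and let $\phi_P$ be a locally surjective (respectively, locally bijective) homomorphism from $D_G$ to $D_H$. Let $E_G$ be an extension of $D_G$ that can be minimally $\phi_P$-S-mapped (respectively, minimally $\phi_P$-B-mapped) to an extension $E_H$ of $D_H$. Then $E_G\setminus V(D_G)$ has at most $|V(D_G)|\cdot|V(E_H)\setminus V(D_H)|$ connected components.
   Context: Host graphs may have self-loops (with $u\in N(u)$ if $uu$ is an edge); guest graphs do not. A homomorphism is locally surjective (resp. bijective) if for every vertex $u$ of its domain its restriction to $N(u)$ is surjective (resp. bijective) onto the neighbourhood of the image of $u$. An extension of a graph $D$ is a graph containing $D$ as an induced subgraph; two extensions are equivalent if isomorphic via an isomorphism fixing $D$ pointwise; a type is an equivalence class of extensions $E$ of $D$ with $E\setminus V(D)$ connected; $\mathrm{tc}_E(T)$ counts components $C$ of $E\setminus V(D)$ with $E[V(D)\cup C]$ of type $T$; $E'\preceq E$ means $\mathrm{tc}_{E'}(T)\le\mathrm{tc}_E(T)$ for every type $T$. A map $\phi:V(E_G)\to V(E_H)$ augments $\phi_P$ if $v\in V(D_G)\Leftrightarrow\phi(v)\in V(D_H)$ and $\phi$ agrees with $\phi_P$ on $V(D_G)$. $E_G$ can be $\phi_P$-S-mapped (resp. $\phi_P$-B-mapped) to $E_H$ if some augmentation of $\phi_P$ is a locally surjective (resp. bijective) homomorphism from $E_G$ to $E_H$; it can be minimally so mapped if moreover no other extension $E'\preceq E_G$ of $D_G$ can be so mapped to $E_H$. -}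

module Defs where

open import Data.Nat using (ℕ; _*_; _∸_; _≤_)
open import Data.Fin using (Fin)
open import Data.Bool using (Bool; true; false)
open import Data.Product using (Σ; ∃; _×_; _,_)
open import Data.Sum using (_⊎_)
open import Relation.Nullary using (¬_)
open import Relation.Binary.PropositionalEquality using (_≡_)

-- A finite graph on vertex set Fin n, given by a symmetric Boolean
-- adjacency relation. Self-loops are allowed (host graphs); a loop at u
-- means adj u u ≡ true, i.e. u ∈ N(u).
record Graph (n : ℕ) : Set where
  field
    adj : Fin n → Fin n → Bool
    sym : ∀ u v → adj u v ≡ adj v u
open Graph public

Loopless : ∀ {n} → Graph n → Set
Loopless G = ∀ u → adj G u u ≡ false

InjectiveMap : ∀ {a b} → (Fin a → Fin b) → Set
InjectiveMap f = ∀ x y → f x ≡ f y → x ≡ y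

SurjectiveMap : ∀ {a b} → (Fin a → Fin b) → Set
SurjectiveMap {a} f = ∀ y → Σ (Fin a) λ x → f x ≡ y

IsHom : ∀ {a b} → Graph a → Graph b → (Fin a → Fin b) → Set
IsHom G H φ = ∀ u v → adj G u v ≡ true → adj H (φ u) (φ v) ≡ true

LocSurj : ∀ {a b} → Graph a → Graph b → (Fin a → Fin b) → Set
LocSurj {a} G H φ = ∀ u w → adj H (φ u) w ≡ true →
  Σ (Fin a) λ v → adj G u v ≡ true × φ v ≡ w

LocInj : ∀ {a b} → Graph a → (Fin a → Fin b) → Set
LocInj G φ = ∀ u v v' → adj G u v ≡ true → adj G u v' ≡ true →
  φ v ≡ φ v' → v ≡ v'

data Mode : Set where
  S B : Mode

LocHom : Mode → ∀ {a b} → Graph a → Graph b → (Fin a → Fin b) → Set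
LocHom S G H φ = IsHom G H φ × LocSurj G H φ
LocHom B G H φ = IsHom G H φ × LocSurj G H φ × LocInj G φ

record Ext {n : ℕ} (D : Graph n) (m : ℕ) : Set where
  field
    graph   : Graph m
    emb     : Fin n → Fin m
    emb-inj : InjectiveMap emb
    induced : ∀ u v → adj graph (emb u) (emb v) ≡ adj D u v
open Ext public

module _ {n : ℕ} {D : Graph n} where

  InD : ∀ {m} → Ext D m → Fin m → Set
  InD {m} E v = Σ (Fin n) λ u → emb E u ≡ v

  Out : ∀ {m} → Ext D m → Fin m → Set
  Out E v = ¬ InD E v

  data Reach {m} (E : Ext D m) : Fin m → Fin m → Set where
    here : ∀ {v} → Out E v → Reach E v v
    step : ∀ {u w v} → Out E u → adj (graph E) u w ≡ true →
           Reach E w v → Reach E u v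

  Equiv : ∀ {m m'} → Ext D m → Ext D m' → Set
  Equiv {m} {m'} E E' = Σ (Fin m → Fin m') λ σ →
    InjectiveMap σ × SurjectiveMap σ ×
    (∀ u → σ (emb E u) ≡ emb E' u) ×
    (∀ x y → adj (graph E') (σ x) (σ y) ≡ adj (graph E) x y)

  IsType : ∀ {r} → Ext D r → Set
  IsType {r} R = (Σ (Fin r) λ v → Out R v) ×
    (∀ u v → Out R u → Out R v → Reach R u v)

  -- The component C of E ∖ V(D) containing c is such that E[V(D) ∪ C]
  -- is equivalent to R (an isomorphism from R onto E[V(D) ∪ C] fixing D).
  CompOfType : ∀ {m r} → Ext D m → Fin m → Ext D r → Set
  CompOfType {m} {r} E c R = Σ (Fin r → Fin m) λ σ →
    InjectiveMap σ ×
    (∀ x → InD E (σ x) ⊎ Reach E c (σ x)) ×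
    (∀ v → InD E v ⊎ Reach E c v → Σ (Fin r) λ x → σ x ≡ v) ×
    (∀ u → σ (emb R u) ≡ emb E u) ×
    (∀ x y → adj (graph E) (σ x) (σ y) ≡ adj (graph R) x y)

  -- tc_E(R) ≥ k : there are k distinct components of E ∖ V(D) of type [R].
  AtLeast : ∀ {m r} → Ext D m → Ext D r → ℕ → Set
  AtLeast {m} E R k = Σ (Fin k → Fin m) λ f →
    (∀ i → Out E (f i)) ×
    (∀ i j → Reach E (f i) (f j) → i ≡ j) ×
    (∀ i → CompOfType E (f i) R)

  -- E' ⪯ E : tc_{E'}(T) ≤ tc_E(T) for every type T.
  _⪯_ : ∀ {m' m} → Ext D m' → Ext D m → Set
  E' ⪯ E = ∀ r (R : Ext D r) → IsType R → ∀ k → AtLeast E' R k → AtLeast E R k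

  AtMostComponents : ∀ {m} → Ext D m → ℕ → Set
  AtMostComponents {m} E N = ∀ k (f : Fin k → Fin m) →
    (∀ i → Out E (f i)) →
    (∀ i j → Reach E (f i) (f j) → i ≡ j) → k ≤ N

Augments : ∀ {nG nH mG mH} {DG : Graph nG} {DH : Graph nH} →
  (Fin nG → Fin nH) → Ext DG mG → Ext DH mH → (Fin mG → Fin mH) → Set
Augments φP EG EH φ =
  (∀ v → (InD EG v → InD EH (φ v)) × (InD EH (φ v) → InD EG v)) ×
  (∀ u → φ (emb EG u) ≡ emb EH (φP u))

Mapped : Mode → ∀ {nG nH mG mH} {DG : Graph nG} {DH : Graph nH} →
  (Fin nG → Fin nH) → Ext DG mG → Ext DH mH → Set
Mapped md {mG = mG} {mH} φP EG EH = Σ (Fin mG → Fin mH) λ φ →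
  Augments φP EG EH φ × LocHom md (graph EG) (graph EH) φ

MinMapped : Mode → ∀ {nG nH mG mH} {DG : Graph nG} {DH : Graph nH} →
  (Fin nG → Fin nH) → Ext DG mG → Ext DH mH → Set
MinMapped md {DG = DG} φP EG EH = Mapped md φP EG EH ×
  (∀ m' (E' : Ext DG m') → Loopless (graph E') → E' ⪯ EG →
     ¬ Equiv E' EG → ¬ Mapped md φP E' EH)

{-# OPTIONS --safe #-}
module Submission where

-- For each vertex u of D_G and each neighbour w of φ(u) outside D_H, local surjectivity lets us fix
-- a neighbour lift(u, w) of u with φ(lift(u, w)) = w; there are at most |V(D_G)|·|V(E_H) ∖ V(D_H)|
-- such pairs. A component C of E_G ∖ V(D_G) containing no lift(u, w) can be deleted: φ restricted
-- to E_G ∖ C is still locally surjective (resp. bijective), since vertices of D_G find their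
-- neighbours in D_H through φP and their other neighbours among the lifts, and vertices outside
-- D_G have all their neighbours outside C. The result is a smaller extension E' ⪯ E_G, which
-- contradicts minimality. So distinct components contain lifts of distinct pairs (u, w).
-- The case distinctions are classical, which is harmless because the conclusion is decidable.

open import Defs
open import Data.Nat using (ℕ; zero; suc; _*_; _∸_; _≤_; _<_; s≤s; _≤?_)
open import Data.Nat.Properties using (+-comm; m+n≤o⇒m≤o∸n; *-distribˡ-∸; ≤⇒≯)
open import Data.Fin using (Fin; zero; suc; splitAt; join; combine; remQuot) renaming (_≟_ to _≟ᶠ_)
open import Data.Fin.Properties
  using (suc-injective; any?; injective⇒≤; combine-injective; combine-remQuot; join-splitAt)
open import Data.Bool using (true; false)
open import Data.Product using (∃; _×_; _,_; proj₁; proj₂; uncurry)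
open import Data.Sum using (_⊎_; inj₁; inj₂; [_,_]) renaming (map to map-⊎)
open import Data.Empty using (⊥-elim)
open import Function using (_∘_)
open import Relation.Nullary using (¬_; Dec; yes; no; contradiction)
open import Relation.Nullary.Decidable using (decidable-stable; ¬¬-excluded-middle; ¬?)
open import Relation.Binary.PropositionalEquality
  using (_≡_; refl; trans; cong; cong₂; subst) renaming (sym to ≡-sym)

¬¬-∀-Fin : ∀ n {P : Fin n → Set} → (∀ i → ¬ ¬ P i) → ¬ ¬ (∀ i → P i)
¬¬-∀-Fin zero      _  ¬∀ = ¬∀ λ ()
¬¬-∀-Fin (suc n) {P} ¬¬P ¬∀ =
  ¬¬P zero λ P₀ → ¬¬-∀-Fin n (¬¬P ∘ suc) λ Pₛ → ¬∀ λ where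
    zero    → P₀
    (suc i) → Pₛ i

disjoint-injections⇒≤∸ : ∀ {b k c} (e : Fin b → Fin c) (h : Fin k → Fin c) →
  InjectiveMap e → InjectiveMap h → (∀ i → ¬ ∃ λ x → e x ≡ h i) → k ≤ c ∸ b
disjoint-injections⇒≤∸ {b} {k} {c} e h e-inj h-inj disjoint =
  m+n≤o⇒m≤o∸n k (subst (_≤ c) (+-comm b k) (injective⇒≤ {f = [ e , h ] ∘ splitAt b} injective))
  where
  copair-injective : ∀ s s′ → [ e , h ] s ≡ [ e , h ] s′ → s ≡ s′
  copair-injective (inj₁ x) (inj₁ y) eq = cong inj₁ (e-inj x y eq)
  copair-injective (inj₁ x) (inj₂ j) eq = ⊥-elim (disjoint j (x , eq))
  copair-injective (inj₂ i) (inj₁ y) eq = ⊥-elim (disjoint i (y , ≡-sym eq))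
  copair-injective (inj₂ i) (inj₂ j) eq = cong inj₂ (h-inj i j eq)

  injective : ∀ {x y} → [ e , h ] (splitAt b x) ≡ [ e , h ] (splitAt b y) → x ≡ y
  injective {x} {y} eq = trans (≡-sym (join-splitAt b k x))
    (trans (cong (join b k) (copair-injective (splitAt b x) (splitAt b y) eq)) (join-splitAt b k y))

pairs-avoiding-image⇒≤ : ∀ {a b c k} (e : Fin b → Fin c) → InjectiveMap e →
  (U : Fin k → Fin a) (W : Fin k → Fin c) → (∀ i → ¬ ∃ λ x → e x ≡ W i) →
  (∀ i j → U i ≡ U j → W i ≡ W j → i ≡ j) → k ≤ a * (c ∸ b)
pairs-avoiding-image⇒≤ {a} {b} {c} {k} e e-inj U W avoid UW-inj =
  subst (k ≤_) (≡-sym (*-distribˡ-∸ a c b))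
    (disjoint-injections⇒≤∸ e′ (λ i → combine (U i) (W i)) e′-inj UW-inj′ disjoint)
  where
  e′ : Fin (a * b) → Fin (a * c)
  e′ t = combine (proj₁ (remQuot {a} b t)) (e (proj₂ (remQuot {a} b t)))

  e′-inj : InjectiveMap e′
  e′-inj t t′ eq with combine-injective (proj₁ (remQuot {a} b t)) _ (proj₁ (remQuot {a} b t′)) _ eq
  ... | q≡q′ , er≡er′ = trans (≡-sym (combine-remQuot {a} b t))
    (trans (cong₂ combine q≡q′ (e-inj _ _ er≡er′)) (combine-remQuot {a} b t′))

  UW-inj′ : InjectiveMap (λ i → combine (U i) (W i))
  UW-inj′ i j eq = uncurry (UW-inj i j) (combine-injective (U i) (W i) (U j) (W j) eq)

  disjoint : ∀ i → ¬ ∃ λ t → e′ t ≡ combine (U i) (W i)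
  disjoint i (t , eq) = avoid i (_ , proj₂ (combine-injective (proj₁ (remQuot {a} b t)) _ (U i) _ eq))

record Enumeration (m : ℕ) (P : Fin m → Set) : Set where
  field
    size      : ℕ
    elem      : Fin size → Fin m
    injective : InjectiveMap elem
    sound     : ∀ x → P (elem x)
    complete  : ∀ v → P v → ∃ λ x → elem x ≡ v
    size<     : (∃ λ v → ¬ P v) → size < m

enumerate : ∀ m (P : Fin m → Set) → (∀ v → Dec (P v)) → Enumeration m P
enumerate zero P P? = record
  { size = 0 ; elem = λ () ; injective = λ () ; sound = λ () ; complete = λ () ; size< = λ { (() , _) } }
enumerate (suc m) P P? with P? zero | enumerate m (P ∘ suc) (P? ∘ suc)
... | yes P₀ | ε = record
  { size = suc size
  ; elem = elem′
  ; injective = injective′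
  ; sound = λ { zero → P₀ ; (suc x) → sound x }
  ; complete = λ { zero _ → zero , refl ; (suc v) Pv → map-suc (complete v Pv) }
  ; size< = λ { (zero , ¬P₀) → contradiction P₀ ¬P₀ ; (suc v , ¬Pv) → s≤s (size< (v , ¬Pv)) } }
  where
  open Enumeration ε
  elem′ : Fin (suc size) → Fin (suc m)
  elem′ zero = zero
  elem′ (suc x) = suc (elem x)
  injective′ : InjectiveMap elem′
  injective′ zero zero _ = refl
  injective′ (suc x) (suc y) eq = cong suc (injective x y (suc-injective eq))
  map-suc : ∀ {v} → (∃ λ x → elem x ≡ v) → ∃ λ x → elem′ x ≡ suc v
  map-suc (x , eq) = suc x , cong suc eq
... | no ¬P₀ | ε = record
  { size = size
  ; elem = suc ∘ elem
  ; injective = λ x y eq → injective x y (suc-injective eq)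
  ; sound = sound
  ; complete = λ { zero P₀ → contradiction P₀ ¬P₀ ; (suc v) Pv → map-suc (complete v Pv) }
  ; size< = λ _ → s≤s (injective⇒≤ (λ {x} {y} → injective x y)) }
  where
  open Enumeration ε
  map-suc : ∀ {v} → (∃ λ x → elem x ≡ v) → ∃ λ x → suc (elem x) ≡ suc v
  map-suc (x , eq) = x , cong suc eq

module _ {n m : ℕ} {D : Graph n} {E : Ext D m} where

  Reach-target-out : ∀ {u v} → Reach E u v → Out E v
  Reach-target-out (here o) = o
  Reach-target-out (step _ _ r) = Reach-target-out r

  Reach-snoc : ∀ {u w v} → Reach E u w → adj (graph E) w v ≡ true → Out E v → Reach E u v
  Reach-snoc (here o) wv ov = step o wv (here ov)
  Reach-snoc (step o uw′ r) wv ov = step o uw′ (Reach-snoc r wv ov)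

  Reach-trans : ∀ {u w v} → Reach E u w → Reach E w v → Reach E u v
  Reach-trans (here _) r′ = r′
  Reach-trans (step o uw r) r′ = step o uw (Reach-trans r r′)

  Reach-sym : ∀ {u v} → Reach E u v → Reach E v u
  Reach-sym (here o) = here o
  Reach-sym {u} (step {w = w} o uw r) = Reach-snoc (Reach-sym r) (trans (Graph.sym (graph E) w u) uw) o

pullback : ∀ {a a′} → Graph a → (Fin a′ → Fin a) → Graph a′
pullback G ι = record { adj = λ x y → adj G (ι x) (ι y) ; sym = λ x y → Graph.sym G (ι x) (ι y) }

LocHom⇒LocSurj : ∀ md {a b} {G : Graph a} {H : Graph b} {φ} → LocHom md G H φ → LocSurj G H φ
LocHom⇒LocSurj S (_ , surj) = surj
LocHom⇒LocSurj B (_ , surj , _) = surj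

LocHom-pullback : ∀ md {a a′ b} {G : Graph a} {H : Graph b} {φ} {ι : Fin a′ → Fin a} →
  InjectiveMap ι → LocHom md G H φ → LocSurj (pullback G ι) H (φ ∘ ι) → LocHom md (pullback G ι) H (φ ∘ ι)
LocHom-pullback S {ι = ι} _ (hom , _) surj = (λ x y → hom (ι x) (ι y)) , surj
LocHom-pullback B {ι = ι} ι-inj (hom , _ , inj) surj =
  (λ x y → hom (ι x) (ι y)) , surj , λ x y y′ xy xy′ eq → ι-inj y y′ (inj (ι x) (ι y) (ι y′) xy xy′ eq)

module Lift {a b} {G : Graph a} {H : Graph b} {φ : Fin a → Fin b} (surj : LocSurj G H φ) where

  lifting : ∀ u w → ∃ λ v → adj H (φ u) w ≡ true → adj G u v ≡ true × φ v ≡ w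
  lifting u w with adj H (φ u) w in uw
  ... | true  = proj₁ (surj u w uw) , λ _ → proj₂ (surj u w uw)
  ... | false = u , λ ()

  lift : Fin a → Fin b → Fin a
  lift u w = proj₁ (lifting u w)

  lift-spec : ∀ {u w} → adj H (φ u) w ≡ true → adj G u (lift u w) ≡ true × φ (lift u w) ≡ w
  lift-spec {u} {w} = proj₂ (lifting u w)

InD? : ∀ {n m} {D : Graph n} (E : Ext D m) v → Dec (InD E v)
InD? E v = any? (λ u → emb E u ≟ᶠ v)

module ComponentDeletion {n m : ℕ} {D : Graph n} (E : Ext D m) (c : Fin m) (c-out : Out E c)
                         (reach? : ∀ v → Dec (Reach E c v)) where

  open Enumeration (enumerate m (λ v → ¬ Reach E c v) (¬? ∘ reach?)) public

  D-kept : ∀ u → ¬ Reach E c (emb E u)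
  D-kept u r = Reach-target-out r (u , refl)

  emb∖C : Fin n → Fin size
  emb∖C u = proj₁ (complete (emb E u) (D-kept u))

  elem-emb∖C : ∀ u → elem (emb∖C u) ≡ emb E u
  elem-emb∖C u = proj₂ (complete (emb E u) (D-kept u))

  E∖C : Ext D size
  E∖C = record
    { graph   = pullback (graph E) elem
    ; emb     = emb∖C
    ; emb-inj = λ u v eq → emb-inj E u v (trans (≡-sym (elem-emb∖C u)) (trans (cong elem eq) (elem-emb∖C v)))
    ; induced = λ u v → trans (cong₂ (adj (graph E)) (elem-emb∖C u) (elem-emb∖C v)) (induced E u v) }

  InD-elem⁺ : ∀ {y} → InD E∖C y → InD E (elem y)
  InD-elem⁺ (u , refl) = u , ≡-sym (elem-emb∖C u)

  InD-elem⁻ : ∀ {y} → InD E (elem y) → InD E∖C y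
  InD-elem⁻ (u , eq) = u , injective _ _ (trans (elem-emb∖C u) eq)

  Out-elem⁺ : ∀ {y} → Out E∖C y → Out E (elem y)
  Out-elem⁺ o = o ∘ InD-elem⁻

  Out-elem⁻ : ∀ {y} → Out E (elem y) → Out E∖C y
  Out-elem⁻ o = o ∘ InD-elem⁺

  -- C is a component, so an outside neighbour of a kept vertex is kept.
  kept-closed : ∀ x {v} → Out E (elem x) → adj (graph E) (elem x) v ≡ true → ∃ λ y → elem y ≡ v
  kept-closed x {v} o xv =
    complete v λ r → sound x (Reach-snoc r (trans (Graph.sym (graph E) v (elem x)) xv) o)

  Reach-elem⁺ : ∀ {x y} → Reach E∖C x y → Reach E (elem x) (elem y)
  Reach-elem⁺ (here o) = here (Out-elem⁺ o)
  Reach-elem⁺ (step o xy r) = step (Out-elem⁺ o) xy (Reach-elem⁺ r)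

  Reach-elem⁻ : ∀ x {v} → Reach E (elem x) v → ∃ λ y → elem y ≡ v × Reach E∖C x y
  Reach-elem⁻ x (here o) = x , refl , here (Out-elem⁻ o)
  Reach-elem⁻ x (step o xw r) with kept-closed x o xw
  ... | x′ , refl with Reach-elem⁻ x′ r
  ...   | y , refl , r′ = y , refl , step (Out-elem⁻ o) xw r′

  CompOfType-elem : ∀ {r} {R : Ext D r} y → CompOfType E∖C y R → CompOfType E (elem y) R
  CompOfType-elem y (σ , σ-inj , σ-in , σ-onto , σ-emb , σ-adj) =
    elem ∘ σ , (λ x x′ → σ-inj x x′ ∘ injective _ _) , map-⊎ InD-elem⁺ Reach-elem⁺ ∘ σ-in ,
    onto , (λ u → trans (cong elem (σ-emb u)) (elem-emb∖C u)) , σ-adj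
    where
    onto : ∀ v → InD E v ⊎ Reach E (elem y) v → ∃ λ x → elem (σ x) ≡ v
    onto _ (inj₁ (u , refl)) with σ-onto (emb∖C u) (inj₁ (u , refl))
    ... | x , σx≡ = x , trans (cong elem σx≡) (elem-emb∖C u)
    onto _ (inj₂ r) with Reach-elem⁻ y r
    ... | y′ , refl , r′ with σ-onto y′ (inj₂ r′)
    ...   | x , σx≡ = x , cong elem σx≡

  E∖C-⪯ : E∖C ⪯ E
  E∖C-⪯ _ R _ _ (g , g-out , g-distinct , g-type) =
    elem ∘ g , Out-elem⁺ ∘ g-out , distinct , λ i → CompOfType-elem {R = R} (g i) (g-type i)
    where
    distinct : ∀ i j → Reach E (elem (g i)) (elem (g j)) → i ≡ j
    distinct i j r with Reach-elem⁻ (g i) r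
    ... | y , eq , r′ = g-distinct i j (subst (Reach E∖C (g i)) (injective _ _ eq) r′)

  E∖C-≄ : ¬ Equiv E∖C E
  E∖C-≄ (σ , _ , σ-onto , _) =
    ≤⇒≯ (injective⇒≤ {f = proj₁ ∘ σ-onto} section-injective) (size< (c , λ ¬r → ¬r (here c-out)))
    where
    section-injective : ∀ {v v′} → proj₁ (σ-onto v) ≡ proj₁ (σ-onto v′) → v ≡ v′
    section-injective {v} {v′} eq =
      trans (≡-sym (proj₂ (σ-onto v))) (trans (cong σ eq) (proj₂ (σ-onto v′)))

  Augments-elem : ∀ {n′ m′} {D′ : Graph n′} {E′ : Ext D′ m′} {φP} {φ : Fin m → Fin m′} →
    Augments φP E E′ φ → Augments φP E∖C E′ (φ ∘ elem)
  Augments-elem {φ = φ} (preserves-D , φ-emb) =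
    (λ y → proj₁ (preserves-D (elem y)) ∘ InD-elem⁺ , InD-elem⁻ ∘ proj₂ (preserves-D (elem y))) ,
    λ u → trans (cong φ (elem-emb∖C u)) (φ-emb u)

module WitnessedComponents (md : Mode) {nG nH mG mH : ℕ} {DG : Graph nG} {DH : Graph nH}
  {φP : Fin nG → Fin nH} {EG : Ext DG mG} {EH : Ext DH mH} (φP-hom : LocHom md DG DH φP)
  {φ : Fin mG → Fin mH} (φ-aug : Augments φP EG EH φ) (φ-hom : LocHom md (graph EG) (graph EH) φ) where

  open Lift {G = graph EG} {H = graph EH} (LocHom⇒LocSurj md φ-hom)

  record Witness (c : Fin mG) : Set where
    field
      u     : Fin nG
      w     : Fin mH
      edge  : adj (graph EH) (φ (emb EG u)) w ≡ true
      w-out : Out EH w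
      reach : Reach EG c (lift (emb EG u) w)
  open Witness

  witnessed-components-≤ : ∀ {k} (f : Fin k → Fin mG) → (∀ i j → Reach EG (f i) (f j) → i ≡ j) →
    (∀ i → Witness (f i)) → k ≤ nG * (mH ∸ nH)
  witnessed-components-≤ f distinct wit =
    pairs-avoiding-image⇒≤ (emb EH) (emb-inj EH) (u ∘ wit) (w ∘ wit) (w-out ∘ wit) same-witness
    where
    same-witness : ∀ i j → u (wit i) ≡ u (wit j) → w (wit i) ≡ w (wit j) → i ≡ j
    same-witness i j u≡ w≡ = distinct i j (Reach-trans (reach (wit i)) (Reach-sym
      (subst (Reach EG (f j)) (≡-sym (cong₂ (lift ∘ emb EG) u≡ w≡)) (reach (wit j)))))

  restricts-to-DH : ∀ u₀ w₀ → adj (graph EH) (φ (emb EG u₀)) (emb EH w₀) ≡ true → adj DH (φP u₀) w₀ ≡ true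
  restricts-to-DH u₀ w₀ h = trans (≡-sym (induced EH (φP u₀) w₀))
    (subst (λ z → adj (graph EH) z (emb EH w₀) ≡ true) (proj₂ φ-aug u₀) h)

  module _ (c : Fin mG) (c-out : Out EG c) (reach? : ∀ v → Dec (Reach EG c v))
           (unwitnessed : ¬ Witness c) where
    open ComponentDeletion EG c c-out reach?

    LiftsTo : Fin mG → Fin mH → Set
    LiftsTo x₀ w′ = ∃ λ y → adj (graph EG) x₀ (elem y) ≡ true × φ (elem y) ≡ w′

    kept-lift : ∀ {x₀ v w′} → (∃ λ y → elem y ≡ v) → adj (graph EG) x₀ v ≡ true → φ v ≡ w′ → LiftsTo x₀ w′
    kept-lift (y , refl) x₀v φv = y , x₀v , φv

    lifts-from-D : ∀ u₀ {w′} → adj (graph EH) (φ (emb EG u₀)) w′ ≡ true → LiftsTo (emb EG u₀) w′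
    lifts-from-D u₀ {w′} h with InD? EH w′
    ... | no w′-out =
      kept-lift (complete _ λ r → unwitnessed (record { edge = h ; w-out = w′-out ; reach = r }))
        (proj₁ (lift-spec h)) (proj₂ (lift-spec h))
    ... | yes (w₀ , refl) with LocHom⇒LocSurj md φP-hom u₀ w₀ (restricts-to-DH u₀ w₀ h)
    ...   | v , u₀v , φPv = kept-lift (emb∖C v , elem-emb∖C v) (trans (induced EG u₀ v) u₀v)
      (trans (proj₂ φ-aug v) (cong (emb EH) φPv))

    lifts-from-outside : ∀ x {w′} → Out EG (elem x) → adj (graph EH) (φ (elem x)) w′ ≡ true → LiftsTo (elem x) w′
    lifts-from-outside x o h with LocHom⇒LocSurj md φ-hom (elem x) _ h
    ... | v , xv , φv = kept-lift (kept-closed x o xv) xv φv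

    E∖C-locSurj : LocSurj (graph E∖C) (graph EH) (φ ∘ elem)
    E∖C-locSurj x w′ h with InD? EG (elem x)
    ... | yes (u₀ , eq) = subst (λ z → LiftsTo z w′) eq
      (lifts-from-D u₀ (subst (λ z → adj (graph EH) (φ z) w′ ≡ true) (≡-sym eq) h))
    ... | no o = lifts-from-outside x o h

    E∖C-mapped : Mapped md φP E∖C EH
    E∖C-mapped =
      φ ∘ elem , Augments-elem {E′ = EH} φ-aug , LocHom-pullback md {ι = elem} injective φ-hom E∖C-locSurj

lemma14 : (md : Mode) (nG nH mG mH : ℕ) (DG : Graph nG) (DH : Graph nH)
    (φP : Fin nG → Fin nH) (EG : Ext DG mG) (EH : Ext DH mH) →
    Loopless DG → Loopless (graph EG) →
    LocHom md DG DH φP →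
    MinMapped md φP EG EH →
    AtMostComponents EG (nG * (mH ∸ nH))
lemma14 md nG nH mG mH DG DH φP EG EH _ EG-loopless φP-hom ((φ , φ-aug , φ-hom) , minimal)
        k f f-out f-distinct =
  decidable-stable (k ≤? nG * (mH ∸ nH)) λ k≰ →
    ¬¬-excluded-middle {A = ∃ λ i → ¬ Witness (f i)} λ where
      (yes (i , unwitnessed)) → ¬¬-∀-Fin mG (λ _ → ¬¬-excluded-middle) λ reach? →
        let open ComponentDeletion EG (f i) (f-out i) reach? in
        minimal size E∖C (EG-loopless ∘ elem) E∖C-⪯ E∖C-≄
          (E∖C-mapped (f i) (f-out i) reach? unwitnessed)
      (no all-witnessed) → ¬¬-∀-Fin k (λ i unwitnessed → all-witnessed (i , unwitnessed)) λ wit →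
        k≰ (witnessed-components-≤ f f-distinct wit)
  where open WitnessedComponents md {EG = EG} {EH = EH} φP-hom φ-aug φ-hom
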